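{- Let $T$ be a tree (with at least two vertices) different from the path $P_2$. Then the following statements are equivalent: (i) $\gamma_M(T)=\ell(T)$; (ii) $\gamma(T)=|\mathcal{S}(T)|$; (iii) for every vertex $u\in V(T)$ there exists a leaf at distance at most $2$ from $u$.
   Context: All graphs are finite, simple, undirected and connected, with at least $2$ vertices; $d(u,v)$ is the length of a shortest $u$-$v$ path. A set $S\subseteq V(G)$ is a resolving set if for every two distinct vertices $x,y$ there is $u\in S$ with $d(u,x)\neq d(u,y)$. $S$ is a dominating set if every vertex not in $S$ has a neighbor in $S$; $\gamma(G)$ is the minimum size of a dominating set. $S$ is a metric-locating-dominating set if it is both resolving and dominating; $\gamma_M(G)$ is the minimum size of such a set. In a tree $T$, a leaf is a vertex of degree 1, $\ell(T)$ is the number of leaves of $T$, a support vertex is a vertex adjacent to a leaf, and $\mathcal{S}(T)$ is the set of support vertices of $T$. -}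

module Defs where

open import Data.Nat using (ℕ; zero; suc; _≤_; _≡ᵇ_)
open import Data.Bool using (Bool; true; false; _∧_; _∨_)
open import Data.Fin using (Fin)
import Data.Fin as F
open import Data.Fin.Subset using (Subset; _∈_; _∉_; ∣_∣)
open import Data.Vec using (tabulate)
open import Data.List using (List; _∷_; []; length; _∷ʳ_)
open import Data.List.Relation.Unary.Linked using (Linked)
open import Data.List.Relation.Unary.Unique.Propositional using (Unique)
open import Data.Product using (Σ; ∃; ∃-syntax; _×_)
open import Relation.Binary.PropositionalEquality using (_≡_; _≢_)
open import Relation.Nullary using (¬_)

record Graph (n : ℕ) : Set where
  field
    adj    : Fin n → Fin n → Bool
    sym    : ∀ u v → adj u v ≡ adj v u
    irrefl : ∀ u → adj u u ≡ false

module _ {n : ℕ} (G : Graph n) where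
  open Graph G

  Edge : Fin n → Fin n → Set
  Edge u v = adj u v ≡ true

  data Walk : Fin n → Fin n → ℕ → Set where
    here : ∀ {u} → Walk u u 0
    step : ∀ {u w v k} → Edge u w → Walk w v k → Walk u v (suc k)

  Connected : Set
  Connected = ∀ u v → ∃[ k ] Walk u v k

  -- a cycle v ∷ vs: at least 3 distinct vertices, consecutive ones adjacent,
  -- and the last adjacent to the first
  IsCycle : Fin n → List (Fin n) → Set
  IsCycle v vs = (2 ≤ length vs) × Unique (v ∷ vs) × Linked Edge ((v ∷ vs) ∷ʳ v)

  Acyclic : Set
  Acyclic = ∀ v vs → ¬ IsCycle v vs

  IsTree : Set
  IsTree = Connected × Acyclic

  Dist : Fin n → Fin n → ℕ → Set
  Dist u v k = Walk u v k × (∀ m → Walk u v m → k ≤ m)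

  degree : Fin n → ℕ
  degree u = ∣ tabulate (adj u) ∣

  IsLeaf : Fin n → Set
  IsLeaf u = degree u ≡ 1

  isLeafᵇ : Fin n → Bool
  isLeafᵇ u = degree u ≡ᵇ 1

  anyFin : ∀ {m} → (Fin m → Bool) → Bool
  anyFin {zero} f = false
  anyFin {suc m} f = f F.zero ∨ anyFin (λ i → f (F.suc i))

  isSupportᵇ : Fin n → Bool
  isSupportᵇ u = anyFin (λ v → adj u v ∧ isLeafᵇ v)

  leaves : Subset n
  leaves = tabulate isLeafᵇ

  supports : Subset n
  supports = tabulate isSupportᵇ

  numLeaves : ℕ
  numLeaves = ∣ leaves ∣

  numSupports : ℕ
  numSupports = ∣ supports ∣

  Resolving : Subset n → Set
  Resolving S = ∀ x y → x ≢ y →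
    ∃[ u ] (u ∈ S × ∃[ k₁ ] ∃[ k₂ ] (Dist u x k₁ × Dist u y k₂ × k₁ ≢ k₂))

  Dominating : Subset n → Set
  Dominating S = ∀ v → v ∉ S → ∃[ u ] (u ∈ S × Edge v u)

  MetricLocatingDominating : Subset n → Set
  MetricLocatingDominating S = Resolving S × Dominating S

IsMinSize : ∀ {n} → (Subset n → Set) → ℕ → Set
IsMinSize {n} P k = (∃[ S ] (P S × ∣ S ∣ ≡ k)) × (∀ S → P S → k ≤ ∣ S ∣)

DominationNumberIs : ∀ {n} → Graph n → ℕ → Set
DominationNumberIs G k = IsMinSize (Dominating G) k

MLDNumberIs : ∀ {n} → Graph n → ℕ → Set
MLDNumberIs G k = IsMinSize (MetricLocatingDominating G) k

-- Let D be a dominating set. Each support vertex either lies in D or has a leaf, which D then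
-- contains; as a leaf has a single neighbour and, in a tree with at least three vertices, is not
-- itself a support vertex, this injects S(T) into D, so γ(T) ≥ |S(T)|. Likewise, sending each leaf
-- to itself or to a neighbour dominating it injects the leaves into any metric-locating-dominating
-- set: two leaves with a common neighbour are equidistant from every other vertex, so one of them
-- must belong to the set. Both injections only hit leaves and support vertices, while a vertex
-- with no leaf within distance 2 is dominated by a vertex that is neither; so each of (i) and (ii)
-- forces (iii). Conversely, under (iii) the support vertices dominate T, and adding all but one
-- leaf of each support vertex gives a set of size ℓ(T) that also resolves T: a pair it does not
-- obviously separate consists of two neighbours x, y of a support vertex with y not a leaf, and a
-- support vertex at distance 1 or 2 from y, away from x, has another distance to x since T has
-- no 4- or 6-cycle.
module Submission where

open import Defs
open import Data.Bool using (Bool; true; false; _∧_)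
import Data.Bool.Properties as Bool
open import Data.Empty using (⊥; ⊥-elim)
open import Data.Fin using (Fin)
import Data.Fin as F
import Data.Fin.Properties as FP
open import Data.Fin.Subset using (Subset; _∈_; _∉_; ∣_∣; inside; outside; _-_; ⁅_⁆; Nonempty)
open import Data.Fin.Subset.Properties
  using (_∈?_; p─⊥≡p; p─q⊆p; x∈p∧x≢y⇒x∈p-y; x∈p⇒∣p-x∣<∣p∣)
open import Data.List using (_∷_; [])
open import Data.List.Relation.Unary.All using (_∷_; [])
open import Data.List.Relation.Unary.AllPairs using (_∷_; [])
open import Data.List.Relation.Unary.Linked using (_∷_; [-])
open import Data.Nat using (ℕ; zero; suc; _≤_; _<_; z≤n; s≤s)
import Data.Nat.Properties as ℕ
open import Data.Product using (∃-syntax; _×_; _,_; proj₁; proj₂)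
open import Data.Sum using (_⊎_; inj₁; inj₂; [_,_])
open import Data.Vec using (_∷_; []; tabulate)
import Data.Vec.Base as Vec
open import Data.Vec.Properties using (lookup⇒[]=; []=⇒lookup; lookup∘tabulate)
open import Function using (_∘_; Equivalence; _⇔_; mk⇔)
open import Relation.Binary using (tri<; tri≈; tri>)
open import Relation.Binary.PropositionalEquality
  using (_≡_; _≢_; ≢-sym; refl; sym; trans; cong; subst)
open import Relation.Nullary using (¬_; Dec; yes; no; does)
open import Relation.Nullary.Decidable using (_×-dec_; _⊎-dec_; map′; dec-true)
open import Relation.Unary using (Pred; Decidable)

least-ℕ : ∀ {ℓ} {P : Pred ℕ ℓ} → Decidable P → ∀ {k} → P k →
  ∃[ m ] (P m × ∀ j → P j → m ≤ j)
least-ℕ P? {zero} P0 = zero , P0 , λ _ _ → z≤n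
least-ℕ P? {suc k} Pk with P? zero
... | yes P0 = zero , P0 , λ _ _ → z≤n
... | no ¬P0 with least-ℕ (P? ∘ suc) Pk
... | m , Pm , minimal =
  suc m , Pm , λ { zero P0 → ⊥-elim (¬P0 P0) ; (suc j) Pj → s≤s (minimal j Pj) }

least-Fin : ∀ {n ℓ} {P : Pred (Fin n) ℓ} → Decidable P → ∀ {i} → P i →
  ∃[ m ] (P m × ∀ j → P j → m F.≤ j)
least-Fin P? {F.zero} P0 = F.zero , P0 , λ _ _ → z≤n
least-Fin P? {F.suc i} Pi with P? F.zero
... | yes P0 = F.zero , P0 , λ _ _ → z≤n
... | no ¬P0 with least-Fin (P? ∘ F.suc) Pi
... | m , Pm , minimal =
  F.suc m , Pm , λ { F.zero P0 → ⊥-elim (¬P0 P0) ; (F.suc j) Pj → s≤s (minimal j Pj) }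

third-element : ∀ {n} → 3 ≤ n → (a b : Fin n) → ∃[ c ] (c ≢ a × c ≢ b)
third-element (s≤s (s≤s (s≤s _))) F.zero F.zero = F.suc F.zero , (λ ()) , (λ ())
third-element (s≤s (s≤s (s≤s _))) F.zero (F.suc F.zero) = F.suc (F.suc F.zero) , (λ ()) , (λ ())
third-element (s≤s (s≤s (s≤s _))) F.zero (F.suc (F.suc _)) = F.suc F.zero , (λ ()) , (λ ())
third-element (s≤s (s≤s (s≤s _))) (F.suc F.zero) F.zero = F.suc (F.suc F.zero) , (λ ()) , (λ ())
third-element (s≤s (s≤s (s≤s _))) (F.suc F.zero) (F.suc _) = F.zero , (λ ()) , (λ ())
third-element (s≤s (s≤s (s≤s _))) (F.suc (F.suc _)) F.zero = F.suc F.zero , (λ ()) , (λ ())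
third-element (s≤s (s≤s (s≤s _))) (F.suc (F.suc _)) (F.suc _) = F.zero , (λ ()) , (λ ())

∈-tabulate⁺ : ∀ {n} (f : Fin n → Bool) {x} → f x ≡ true → x ∈ tabulate f
∈-tabulate⁺ f {x} fx = lookup⇒[]= x (tabulate f) (trans (lookup∘tabulate f x) fx)

∈-tabulate⁻ : ∀ {n} (f : Fin n → Bool) {x} → x ∈ tabulate f → f x ≡ true
∈-tabulate⁻ f {x} x∈ = trans (sym (lookup∘tabulate f x)) ([]=⇒lookup x∈)

subsetOf : ∀ {n ℓ} {P : Pred (Fin n) ℓ} → Decidable P → Subset n
subsetOf P? = tabulate (does ∘ P?)

∈subsetOf⁺ : ∀ {n ℓ} {P : Pred (Fin n) ℓ} (P? : Decidable P) {x} → P x → x ∈ subsetOf P?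
∈subsetOf⁺ P? {x} Px = ∈-tabulate⁺ _ (dec-true (P? x) Px)

∈subsetOf⁻ : ∀ {n ℓ} {P : Pred (Fin n) ℓ} (P? : Decidable P) {x} → x ∈ subsetOf P? → P x
∈subsetOf⁻ P? {x} x∈ with P? x | ∈-tabulate⁻ (does ∘ P?) x∈
... | yes Px | _ = Px

∣p∣≡1+∣p-x∣ : ∀ {n} {p : Subset n} {x} → x ∈ p → ∣ p ∣ ≡ suc ∣ p - x ∣
∣p∣≡1+∣p-x∣ {p = inside ∷ p} Vec.here = cong (suc ∘ ∣_∣) (sym (p─⊥≡p p))
∣p∣≡1+∣p-x∣ {p = inside ∷ p} (Vec.there x∈p) = cong suc (∣p∣≡1+∣p-x∣ x∈p)
∣p∣≡1+∣p-x∣ {p = outside ∷ p} (Vec.there x∈p) = ∣p∣≡1+∣p-x∣ x∈p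

x∈p-y⇒x≢y : ∀ {n} {p : Subset n} {x y} → x ∈ p - y → x ≢ y
x∈p-y⇒x≢y {p = _ ∷ _} {y = F.zero} (Vec.there _) ()
x∈p-y⇒x≢y {p = _ ∷ _} {y = F.suc y} Vec.here ()
x∈p-y⇒x≢y {p = _ ∷ _} {y = F.suc y} (Vec.there x∈) refl = x∈p-y⇒x≢y x∈ refl

∣p∣≢0⇒nonempty : ∀ {n} {p : Subset n} → ∣ p ∣ ≢ 0 → Nonempty p
∣p∣≢0⇒nonempty {p = []} ∣p∣≢0 = ⊥-elim (∣p∣≢0 refl)
∣p∣≢0⇒nonempty {p = inside ∷ p} _ = F.zero , Vec.here
∣p∣≢0⇒nonempty {p = outside ∷ p} ∣p∣≢0 with ∣p∣≢0⇒nonempty ∣p∣≢0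
... | x , x∈p = F.suc x , Vec.there x∈p

∣p∣≡1⇒x≡y : ∀ {n} {p : Subset n} {x y} → ∣ p ∣ ≡ 1 → x ∈ p → y ∈ p → x ≡ y
∣p∣≡1⇒x≡y {p = p} {x} {y} ∣p∣≡1 x∈p y∈p with y F.≟ x
... | yes y≡x = sym y≡x
... | no y≢x = ⊥-elim (ℕ.1+n≢0 (trans (sym (∣p∣≡1+∣p-x∣ y∈p-x)) ∣p-x∣≡0))
  where
  y∈p-x : y ∈ p - x
  y∈p-x = x∈p∧x≢y⇒x∈p-y y∈p y≢x
  ∣p-x∣≡0 : ∣ p - x ∣ ≡ 0
  ∣p-x∣≡0 = ℕ.suc-injective (trans (sym (∣p∣≡1+∣p-x∣ x∈p)) ∣p∣≡1)

∣p∣≢1⇒another : ∀ {n} {p : Subset n} {x} → ∣ p ∣ ≢ 1 → x ∈ p →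
  ∃[ y ] (y ∈ p × y ≢ x)
∣p∣≢1⇒another {p = p} {x} ∣p∣≢1 x∈p
  with ∣p∣≢0⇒nonempty {p = p - x} (∣p∣≢1 ∘ trans (∣p∣≡1+∣p-x∣ x∈p) ∘ cong suc)
... | y , y∈p-x = y , p─q⊆p p ⁅ x ⁆ y∈p-x , x∈p-y⇒x≢y y∈p-x

module _ {m n} (R : Fin m → Fin n → Set) where

  RelatesInto : Subset m → Subset n → Set
  RelatesInto p q = ∀ {x} → x ∈ p → ∃[ y ] (y ∈ q × R x y)

  InjectiveOn : Subset m → Set
  InjectiveOn p = ∀ {x x′ y} → x ∈ p → x′ ∈ p → R x y → R x′ y → x ≡ x′

  injection⇒∣p∣≤∣q∣ : ∀ {p q} → RelatesInto p q → InjectiveOn p → ∣ p ∣ ≤ ∣ q ∣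
  injection⇒∣p∣≤∣q∣ {p} = go ∣ p ∣ refl
    where
    open ℕ.≤-Reasoning
    go : ∀ k {p q} → ∣ p ∣ ≡ k → RelatesInto p q → InjectiveOn p → ∣ p ∣ ≤ ∣ q ∣
    go zero ∣p∣≡0 _ _ = subst (_≤ _) (sym ∣p∣≡0) z≤n
    go (suc k) {p} {q} ∣p∣≡1+k into inj
      with ∣p∣≢0⇒nonempty {p = p} (ℕ.1+n≢0 ∘ trans (sym ∣p∣≡1+k))
    ... | x , x∈p with into x∈p
    ... | y , y∈q , xRy = begin
      ∣ p ∣          ≡⟨ ∣p∣≡1+∣p-x∣ x∈p ⟩
      suc ∣ p - x ∣  ≤⟨ s≤s (go k ∣p-x∣≡k into′ inj′) ⟩
      suc ∣ q - y ∣  ≡⟨ ∣p∣≡1+∣p-x∣ y∈q ⟨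
      ∣ q ∣          ∎
      where
      ∣p-x∣≡k : ∣ p - x ∣ ≡ k
      ∣p-x∣≡k = ℕ.suc-injective (trans (sym (∣p∣≡1+∣p-x∣ x∈p)) ∣p∣≡1+k)
      ⊆p : ∀ {x′} → x′ ∈ p - x → x′ ∈ p
      ⊆p = p─q⊆p p ⁅ x ⁆
      into′ : RelatesInto (p - x) (q - y)
      into′ x′∈ with into (⊆p x′∈)
      ... | y′ , y′∈q , x′Ry′ = y′ , x∈p∧x≢y⇒x∈p-y y′∈q y′≢y , x′Ry′
        where
        y′≢y : y′ ≢ y
        y′≢y refl = x∈p-y⇒x≢y x′∈ (inj (⊆p x′∈) x∈p x′Ry′ xRy)
      inj′ : InjectiveOn (p - x)
      inj′ x∈ x′∈ = inj (⊆p x∈) (⊆p x′∈)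

  injection-missing⇒∣p∣<∣q∣ : ∀ {p q w} → RelatesInto p q → InjectiveOn p →
    w ∈ q → (∀ {x} → x ∈ p → ¬ R x w) → ∣ p ∣ < ∣ q ∣
  injection-missing⇒∣p∣<∣q∣ {p} {q} {w} into inj w∈q w∉image =
    ℕ.≤-<-trans (injection⇒∣p∣≤∣q∣ into′ inj) (x∈p⇒∣p-x∣<∣p∣ w∈q)
    where
    into′ : RelatesInto p (q - w)
    into′ x∈p with into x∈p
    ... | y , y∈q , xRy = y , x∈p∧x≢y⇒x∈p-y y∈q (λ { refl → w∉image x∈p xRy }) , xRy

module Basics {n} (G : Graph n) where
  open Graph G using (adj; irrefl)

  Edge-sym : ∀ {u v} → Edge G u v → Edge G v u
  Edge-sym {u} {v} uv = trans (Graph.sym G v u) uv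

  Edge⇒≢ : ∀ {u v} → Edge G u v → u ≢ v
  Edge⇒≢ {u} uu refl with trans (sym uu) (irrefl u)
  ... | ()

  edge? : ∀ u v → Dec (Edge G u v)
  edge? u v = adj u v Bool.≟ true

  leaf? : ∀ v → Dec (IsLeaf G v)
  leaf? v = degree G v ℕ.≟ 1

  leaf-neighbour : ∀ {l} → IsLeaf G l → ∃[ s ] Edge G l s
  leaf-neighbour {l} leaf with ∣p∣≢0⇒nonempty {p = tabulate (adj l)} (ℕ.1+n≢0 ∘ trans (sym leaf))
  ... | s , s∈N = s , ∈-tabulate⁻ (adj l) s∈N

  leaf-neighbour-unique : ∀ {l a b} → IsLeaf G l → Edge G l a → Edge G l b → a ≡ b
  leaf-neighbour-unique {l} leaf la lb =
    ∣p∣≡1⇒x≡y leaf (∈-tabulate⁺ (adj l) la) (∈-tabulate⁺ (adj l) lb)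

  non-leaf-another-neighbour : ∀ {v s} → ¬ IsLeaf G v → Edge G v s → ∃[ z ] (Edge G v z × z ≢ s)
  non-leaf-another-neighbour {v} ¬leaf vs with ∣p∣≢1⇒another ¬leaf (∈-tabulate⁺ (adj v) vs)
  ... | z , z∈N , z≢s = z , ∈-tabulate⁻ (adj v) z∈N , z≢s

  anyFin⁺ : ∀ {m} (f : Fin m → Bool) {i} → f i ≡ true → anyFin G f ≡ true
  anyFin⁺ f {F.zero} f0 rewrite f0 = refl
  anyFin⁺ f {F.suc i} fi rewrite anyFin⁺ (f ∘ F.suc) fi = Bool.∨-zeroʳ (f F.zero)

  anyFin⁻ : ∀ {m} (f : Fin m → Bool) → anyFin G f ≡ true → ∃[ i ] f i ≡ true
  anyFin⁻ {suc m} f any with f F.zero in f0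
  ... | true = F.zero , f0
  ... | false with anyFin⁻ (f ∘ F.suc) any
  ... | i , fi = F.suc i , fi

  isLeafᵇ⁺ : ∀ {v} → IsLeaf G v → isLeafᵇ G v ≡ true
  isLeafᵇ⁺ leaf = Equivalence.to Bool.T-≡ (ℕ.≡⇒≡ᵇ _ 1 leaf)

  isLeafᵇ⁻ : ∀ {v} → isLeafᵇ G v ≡ true → IsLeaf G v
  isLeafᵇ⁻ leafᵇ = ℕ.≡ᵇ⇒≡ _ 1 (Equivalence.from Bool.T-≡ leafᵇ)

  ∈leaves⁺ : ∀ {v} → IsLeaf G v → v ∈ leaves G
  ∈leaves⁺ = ∈-tabulate⁺ _ ∘ isLeafᵇ⁺

  ∈leaves⁻ : ∀ {v} → v ∈ leaves G → IsLeaf G v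
  ∈leaves⁻ = isLeafᵇ⁻ ∘ ∈-tabulate⁻ _

  Support : Fin n → Set
  Support s = ∃[ l ] (Edge G s l × IsLeaf G l)

  support? : ∀ s → Dec (Support s)
  support? s = FP.any? (λ l → edge? s l ×-dec leaf? l)

  ∈supports⁺ : ∀ {s} → Support s → s ∈ supports G
  ∈supports⁺ {s} (l , sl , leaf) = ∈-tabulate⁺ _ (anyFin⁺ (λ v → adj s v ∧ isLeafᵇ G v)
    (subst (λ b → b ∧ isLeafᵇ G l ≡ true) (sym sl) (isLeafᵇ⁺ leaf)))

  ∈supports⁻ : ∀ {s} → s ∈ supports G → Support s
  ∈supports⁻ {s} s∈ with anyFin⁻ _ (∈-tabulate⁻ _ s∈)
  ... | l , sl∧leaf with adj s l in sl
  ... | true = l , sl , isLeafᵇ⁻ sl∧leaf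

  Walk-0 : ∀ {u v} → Walk G u v 0 → u ≡ v
  Walk-0 here = refl

  Walk-1 : ∀ {u v} → Walk G u v 1 → Edge G u v
  Walk-1 (step uv here) = uv

  Walk-2 : ∀ {u v} → Walk G u v 2 → ∃[ w ] (Edge G u w × Edge G w v)
  Walk-2 (step uw (step wv here)) = _ , uw , wv

  walk? : ∀ k u v → Dec (Walk G u v k)
  walk? zero u v with u F.≟ v
  ... | yes refl = yes here
  ... | no u≢v = no (u≢v ∘ Walk-0)
  walk? (suc k) u v with FP.any? (λ w → edge? u w ×-dec walk? k w v)
  ... | yes (w , uw , wv) = yes (step uw wv)
  ... | no ∄w = no λ { (step uw wv) → ∄w (_ , uw , wv) }

  Dist-0 : ∀ u → Dist G u u 0
  Dist-0 u = here , λ _ _ → z≤n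

  Dist-1 : ∀ {u v} → Edge G u v → Dist G u v 1
  Dist-1 uv = step uv here , λ
    { zero walk → ⊥-elim (Edge⇒≢ uv (Walk-0 walk))
    ; (suc _) _ → s≤s z≤n }

  Dist-2 : ∀ {u w v} → Edge G u w → Edge G w v → u ≢ v → ¬ Edge G u v → Dist G u v 2
  Dist-2 uw wv u≢v ¬uv = step uw (step wv here) , λ
    { zero walk → ⊥-elim (u≢v (Walk-0 walk))
    ; (suc zero) walk → ⊥-elim (¬uv (Walk-1 walk))
    ; (suc (suc _)) _ → s≤s (s≤s z≤n) }

  NearLeaf : Fin n → Set
  NearLeaf u = ∃[ v ] (IsLeaf G v × ∃[ k ] (k ≤ 2 × Dist G u v k))

  near-leaf-non-support⇒support-neighbour : ∀ {v} → NearLeaf v → ¬ Support v →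
    ∃[ s ] (Support s × Edge G v s)
  near-leaf-non-support⇒support-neighbour (l , leaf , zero , _ , walk , _) _ with Walk-0 walk
  ... | refl with leaf-neighbour leaf
  ... | s , ls = s , (l , Edge-sym ls , leaf) , ls
  near-leaf-non-support⇒support-neighbour (l , leaf , 1 , _ , walk , _) ¬support =
    ⊥-elim (¬support (l , Walk-1 walk , leaf))
  near-leaf-non-support⇒support-neighbour (l , leaf , 2 , _ , walk , _) _ with Walk-2 walk
  ... | s , vs , sl = s , (l , sl , leaf) , vs
  near-leaf-non-support⇒support-neighbour (_ , _ , suc (suc (suc _)) , s≤s (s≤s ()) , _) _

  support-closed⇒dominating : ∀ {D} → (∀ u → NearLeaf u) → (∀ {s} → Support s → s ∈ D) →
    Dominating G D
  support-closed⇒dominating near supports⊆D v v∉D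
    with near-leaf-non-support⇒support-neighbour (near v) (v∉D ∘ supports⊆D)
  ... | s , support , vs = s , supports⊆D support , vs

  ResolvedBy : Subset n → Fin n → Fin n → Set
  ResolvedBy S x y =
    ∃[ u ] (u ∈ S × ∃[ k₁ ] ∃[ k₂ ] (Dist G u x k₁ × Dist G u y k₂ × k₁ ≢ k₂))

  ResolvedBy-sym : ∀ {S x y} → ResolvedBy S x y → ResolvedBy S y x
  ResolvedBy-sym (u , u∈S , k₁ , k₂ , ux , uy , k₁≢k₂) =
    u , u∈S , k₂ , k₁ , uy , ux , k₁≢k₂ ∘ sym

  walk-to-twin : ∀ {a b s u m} → IsLeaf G a → Edge G a s → Edge G b s →
    Walk G u a (suc m) → Walk G u b (suc m)
  walk-to-twin {b = b} leaf as bs (step ua here) =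
    step (subst (λ x → Edge G x b) (leaf-neighbour-unique leaf as (Edge-sym ua)) (Edge-sym bs)) here
  walk-to-twin leaf as bs (step uw (step wv walk)) = step uw (walk-to-twin leaf as bs (step wv walk))

  twin-leaves-resolved⇒member : ∀ {S l l′ s} → Resolving G S → IsLeaf G l → IsLeaf G l′ →
    Edge G l s → Edge G l′ s → l ≢ l′ → l ∈ S ⊎ l′ ∈ S
  twin-leaves-resolved⇒member {S} resolving leaf leaf′ ls l′s l≢l′ with resolving _ _ l≢l′
  ... | u , u∈S , zero , _ , ul , _ , _ = inj₁ (subst (_∈ S) (Walk-0 (proj₁ ul)) u∈S)
  ... | u , u∈S , suc _ , zero , _ , ul′ , _ = inj₂ (subst (_∈ S) (Walk-0 (proj₁ ul′)) u∈S)
  ... | u , u∈S , suc _ , suc _ , (ul , minimal) , (ul′ , minimal′) , k₁≢k₂ =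
    ⊥-elim (k₁≢k₂ (ℕ.≤-antisym (minimal _ (walk-to-twin leaf′ l′s ls ul′))
                               (minimal′ _ (walk-to-twin leaf ls l′s ul))))

module Cycles {n} (G : Graph n) (acyclic : Acyclic G) where
  open Basics G

  no-triangle : ∀ {a b c} → Edge G a b → Edge G b c → Edge G c a → ⊥
  no-triangle ab bc ca = acyclic _ (_ ∷ _ ∷ []) (s≤s (s≤s z≤n) ,
    ((Edge⇒≢ ab ∷ ≢-sym (Edge⇒≢ ca) ∷ []) ∷ (Edge⇒≢ bc ∷ []) ∷ [] ∷ []) ,
    (ab ∷ bc ∷ ca ∷ [-]))

  no-square : ∀ {a b c d} → Edge G a b → Edge G b c → Edge G c d → Edge G d a →
    a ≢ c → b ≢ d → ⊥
  no-square ab bc cd da a≢c b≢d = acyclic _ (_ ∷ _ ∷ _ ∷ []) (s≤s (s≤s z≤n) ,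
    ((Edge⇒≢ ab ∷ a≢c ∷ ≢-sym (Edge⇒≢ da) ∷ []) ∷ (Edge⇒≢ bc ∷ b≢d ∷ []) ∷
     (Edge⇒≢ cd ∷ []) ∷ [] ∷ []) ,
    (ab ∷ bc ∷ cd ∷ da ∷ [-]))

  no-hexagon : ∀ {a b c d e f} →
    Edge G a b → Edge G b c → Edge G c d → Edge G d e → Edge G e f → Edge G f a →
    a ≢ c → a ≢ d → a ≢ e → b ≢ d → b ≢ e → b ≢ f → c ≢ e → c ≢ f → d ≢ f → ⊥
  no-hexagon ab bc cd de ef fa a≢c a≢d a≢e b≢d b≢e b≢f c≢e c≢f d≢f =
    acyclic _ (_ ∷ _ ∷ _ ∷ _ ∷ _ ∷ []) (s≤s (s≤s z≤n) ,
    ((Edge⇒≢ ab ∷ a≢c ∷ a≢d ∷ a≢e ∷ ≢-sym (Edge⇒≢ fa) ∷ []) ∷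
     (Edge⇒≢ bc ∷ b≢d ∷ b≢e ∷ b≢f ∷ []) ∷
     (Edge⇒≢ cd ∷ c≢e ∷ c≢f ∷ []) ∷
     (Edge⇒≢ de ∷ d≢f ∷ []) ∷
     (Edge⇒≢ ef ∷ []) ∷ [] ∷ []) ,
    (ab ∷ bc ∷ cd ∷ de ∷ ef ∷ fa ∷ [-]))

module Distances {n} (G : Graph n) (connected : Connected G) where
  open Basics G

  dist-exists : ∀ u v → ∃[ k ] Dist G u v k
  dist-exists u v = least-ℕ (λ k → walk? k u v) (proj₂ (connected u v))

  member-resolves : ∀ {S u y} → u ∈ S → u ≢ y → ResolvedBy S u y
  member-resolves {u = u} {y} u∈S u≢y with dist-exists u y
  ... | k , uy = u , u∈S , 0 , k , Dist-0 u , uy , λ { refl → u≢y (Walk-0 (proj₁ uy)) }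

  walk⇒near-leaf : ∀ {u v m} → IsLeaf G v → Walk G u v m → m ≤ 2 → NearLeaf u
  walk⇒near-leaf {u} {v} leaf walk m≤2 with dist-exists u v
  ... | k , dist = v , leaf , k , ℕ.≤-trans (proj₂ dist _ walk) m≤2 , dist

  near-leaf? : ∀ u → Dec (NearLeaf u)
  near-leaf? u = map′ from to (FP.any? (λ v → leaf? v ×-dec ℕ.anyUpTo? (λ k → walk? k u v) 3))
    where
    from : ∃[ v ] (IsLeaf G v × ∃[ k ] (k < 3 × Walk G u v k)) → NearLeaf u
    from (v , leaf , k , k<3 , walk) = walk⇒near-leaf leaf walk (ℕ.≤-pred k<3)
    to : NearLeaf u → ∃[ v ] (IsLeaf G v × ∃[ k ] (k < 3 × Walk G u v k))
    to (v , leaf , k , k≤2 , walk , _) = v , leaf , k , s≤s k≤2 , walk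

  far-dominator : ∀ {D u} → Dominating G D → ¬ NearLeaf u →
    ∃[ w ] (w ∈ D × ¬ IsLeaf G w × ¬ Support w)
  far-dominator {D} {u} dominating far with u ∈? D
  ... | yes u∈D = u , u∈D , (λ leaf → far (walk⇒near-leaf leaf here z≤n)) ,
    λ (_ , ul , leaf) → far (walk⇒near-leaf leaf (step ul here) (s≤s z≤n))
  ... | no u∉D with dominating u u∉D
  ... | w , w∈D , uw = w , w∈D , (λ leaf → far (walk⇒near-leaf leaf (step uw here) (s≤s z≤n))) ,
    λ (_ , wl , leaf) → far (walk⇒near-leaf leaf (step uw (step wl here)) (s≤s (s≤s z≤n)))

  tight⇒near-leaf : ∀ {P : Subset n → Set} {k} → IsMinSize P k →
    (∀ {S u} → P S → ¬ NearLeaf u → k < ∣ S ∣) → ∀ u → NearLeaf u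
  tight⇒near-leaf ((S , PS , ∣S∣≡k) , _) far-bound u with near-leaf? u
  ... | yes near = near
  ... | no far = ⊥-elim (ℕ.<-irrefl (sym ∣S∣≡k) (far-bound PS far))

module LowerBounds {n} (G : Graph n) (connected : Connected G) (3≤n : 3 ≤ n) where
  open Basics G
  open Distances G connected

  leaves-nonadjacent : ∀ {a b} → IsLeaf G a → IsLeaf G b → ¬ Edge G a b
  leaves-nonadjacent {a} {b} leafᵃ leafᵇ ab with third-element 3≤n a b
  ... | c , c≢a , c≢b = [ c≢a , c≢b ] (trapped (inj₁ refl) (proj₂ (connected a c)))
    where
    trapped : ∀ {v x k} → v ≡ a ⊎ v ≡ b → Walk G v x k → x ≡ a ⊎ x ≡ b
    trapped v∈ab here = v∈ab
    trapped (inj₁ refl) (step aw walk) = trapped (inj₂ (leaf-neighbour-unique leafᵃ aw ab)) walk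
    trapped (inj₂ refl) (step bw walk) =
      trapped (inj₁ (leaf-neighbour-unique leafᵇ bw (Edge-sym ab))) walk

  leaf⇒¬support : ∀ {v} → IsLeaf G v → ¬ Support v
  leaf⇒¬support leaf (_ , vl , leafˡ) = leaves-nonadjacent leaf leafˡ vl

  SelfOrLeafNeighbour : Fin n → Fin n → Set
  SelfOrLeafNeighbour s b = b ≡ s ⊎ (Edge G s b × IsLeaf G b)

  supports-into-dominating : ∀ {D} → Dominating G D → RelatesInto SelfOrLeafNeighbour (supports G) D
  supports-into-dominating {D} dominating {s} s∈ with s ∈? D
  ... | yes s∈D = s , s∈D , inj₁ refl
  ... | no s∉D with ∈supports⁻ s∈
  ... | l , sl , leaf with l ∈? D
  ... | yes l∈D = l , l∈D , inj₂ (sl , leaf)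
  ... | no l∉D with dominating l l∉D
  ... | w , w∈D , lw = ⊥-elim (s∉D (subst (_∈ D) (leaf-neighbour-unique leaf lw (Edge-sym sl)) w∈D))

  SelfOrLeafNeighbour-injective : InjectiveOn SelfOrLeafNeighbour (supports G)
  SelfOrLeafNeighbour-injective _ _ (inj₁ refl) (inj₁ refl) = refl
  SelfOrLeafNeighbour-injective s∈ _ (inj₁ refl) (inj₂ (_ , leaf)) =
    ⊥-elim (leaf⇒¬support leaf (∈supports⁻ s∈))
  SelfOrLeafNeighbour-injective _ s′∈ (inj₂ (_ , leaf)) (inj₁ refl) =
    ⊥-elim (leaf⇒¬support leaf (∈supports⁻ s′∈))
  SelfOrLeafNeighbour-injective _ _ (inj₂ (sb , leaf)) (inj₂ (s′b , _)) =
    leaf-neighbour-unique leaf (Edge-sym sb) (Edge-sym s′b)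

  numSupports≤dominating : ∀ {D} → Dominating G D → numSupports G ≤ ∣ D ∣
  numSupports≤dominating dominating =
    injection⇒∣p∣≤∣q∣ _ (supports-into-dominating dominating) SelfOrLeafNeighbour-injective

  far-leaf⇒numSupports<dominating : ∀ {D u} → Dominating G D → ¬ NearLeaf u →
    numSupports G < ∣ D ∣
  far-leaf⇒numSupports<dominating dominating far with far-dominator dominating far
  ... | w , w∈D , ¬leaf , ¬support = injection-missing⇒∣p∣<∣q∣ _
    (supports-into-dominating dominating) SelfOrLeafNeighbour-injective w∈D
    λ { s∈ (inj₁ refl) → ¬support (∈supports⁻ s∈) ; _ (inj₂ (_ , leaf)) → ¬leaf leaf }

  SelfOrNeighbourIfOutside : Subset n → Fin n → Fin n → Set
  SelfOrNeighbourIfOutside S l b = b ≡ l ⊎ (l ∉ S × Edge G l b)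

  leaves-into-dominating : ∀ {S} → Dominating G S →
    RelatesInto (SelfOrNeighbourIfOutside S) (leaves G) S
  leaves-into-dominating {S} dominating {l} _ with l ∈? S
  ... | yes l∈S = l , l∈S , inj₁ refl
  ... | no l∉S with dominating l l∉S
  ... | w , w∈S , lw = w , w∈S , inj₂ (l∉S , lw)

  SelfOrNeighbourIfOutside-injective : ∀ {S} → Resolving G S →
    InjectiveOn (SelfOrNeighbourIfOutside S) (leaves G)
  SelfOrNeighbourIfOutside-injective _ _ _ (inj₁ refl) (inj₁ refl) = refl
  SelfOrNeighbourIfOutside-injective _ l∈ l′∈ (inj₁ refl) (inj₂ (_ , l′l)) =
    ⊥-elim (leaves-nonadjacent (∈leaves⁻ l′∈) (∈leaves⁻ l∈) l′l)
  SelfOrNeighbourIfOutside-injective _ l∈ l′∈ (inj₂ (_ , ll′)) (inj₁ refl) =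
    ⊥-elim (leaves-nonadjacent (∈leaves⁻ l∈) (∈leaves⁻ l′∈) ll′)
  SelfOrNeighbourIfOutside-injective resolving {l} {l′} l∈ l′∈ (inj₂ (l∉S , lb)) (inj₂ (l′∉S , l′b))
    with l F.≟ l′
  ... | yes l≡l′ = l≡l′
  ... | no l≢l′ = ⊥-elim ([ l∉S , l′∉S ]
    (twin-leaves-resolved⇒member resolving (∈leaves⁻ l∈) (∈leaves⁻ l′∈) lb l′b l≢l′))

  numLeaves≤mld : ∀ {S} → MetricLocatingDominating G S → numLeaves G ≤ ∣ S ∣
  numLeaves≤mld (resolving , dominating) = injection⇒∣p∣≤∣q∣ _
    (leaves-into-dominating dominating) (SelfOrNeighbourIfOutside-injective resolving)

  far-leaf⇒numLeaves<mld : ∀ {S u} → MetricLocatingDominating G S → ¬ NearLeaf u →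
    numLeaves G < ∣ S ∣
  far-leaf⇒numLeaves<mld (resolving , dominating) far with far-dominator dominating far
  ... | w , w∈S , ¬leaf , ¬support = injection-missing⇒∣p∣<∣q∣ _
    (leaves-into-dominating dominating) (SelfOrNeighbourIfOutside-injective resolving) w∈S
    λ { l∈ (inj₁ refl) → ¬leaf (∈leaves⁻ l∈)
      ; l∈ (inj₂ (_ , lw)) → ¬support (_ , Edge-sym lw , ∈leaves⁻ l∈) }

  γ-tight⇒near-leaf : DominationNumberIs G (numSupports G) → ∀ u → NearLeaf u
  γ-tight⇒near-leaf γ = tight⇒near-leaf γ far-leaf⇒numSupports<dominating

  γM-tight⇒near-leaf : MLDNumberIs G (numLeaves G) → ∀ u → NearLeaf u
  γM-tight⇒near-leaf γM = tight⇒near-leaf γM far-leaf⇒numLeaves<mld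

  near-leaf⇒γ-tight : (∀ u → NearLeaf u) → DominationNumberIs G (numSupports G)
  near-leaf⇒γ-tight near =
    (supports G , support-closed⇒dominating near ∈supports⁺ , refl) , λ _ → numSupports≤dominating

module Construction {n} (G : Graph n) (connected : Connected G) (3≤n : 3 ≤ n) (acyclic : Acyclic G)
                    (near : ∀ u → Basics.NearLeaf G u) where
  open Basics G
  open Distances G connected
  open Cycles G acyclic
  open LowerBounds G connected 3≤n

  Shadowed : Fin n → Set
  Shadowed v = IsLeaf G v × ∃[ w ] (w F.< v × IsLeaf G w × ∃[ s ] (Edge G v s × Edge G w s))

  shadowed? : ∀ v → Dec (Shadowed v)
  shadowed? v = leaf? v ×-dec FP.any? λ w →
    (w F.<? v) ×-dec leaf? w ×-dec FP.any? (λ s → edge? v s ×-dec edge? w s)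

  supports∪shadowed? : ∀ v → Dec (Support v ⊎ Shadowed v)
  supports∪shadowed? v = support? v ⊎-dec shadowed? v

  supports∪shadowed : Subset n
  supports∪shadowed = subsetOf supports∪shadowed?

  support⇒∈ : ∀ {v} → Support v → v ∈ supports∪shadowed
  support⇒∈ = ∈subsetOf⁺ supports∪shadowed? ∘ inj₁

  shadowed⇒∈ : ∀ {v} → Shadowed v → v ∈ supports∪shadowed
  shadowed⇒∈ = ∈subsetOf⁺ supports∪shadowed? ∘ inj₂

  resolve-beside-non-leaf : ∀ {x y s} → x ≢ y → ¬ IsLeaf G y → ¬ Support y →
    Edge G x s → Edge G y s → ResolvedBy supports∪shadowed x y
  resolve-beside-non-leaf {x} {y} {s} x≢y ¬leaf ¬support xs ys with non-leaf-another-neighbour ¬leaf ys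
  ... | z , yz , z≢s with support? z
  ... | yes support-z with dist-exists z x
  ... | k , zx = z , support⇒∈ support-z , k , 1 , zx , Dist-1 (Edge-sym yz) , k≢1
    where
    k≢1 : k ≢ 1
    k≢1 refl = no-square xs (Edge-sym ys) yz (Walk-1 (proj₁ zx)) x≢y (z≢s ∘ sym)
  resolve-beside-non-leaf {x} {y} {s} x≢y ¬leaf ¬support xs ys | z , yz , z≢s | no ¬support-z
    with near-leaf-non-support⇒support-neighbour (near z) ¬support-z
  ... | t , support-t , zt with dist-exists t x
  ... | k , tx =
    t , support⇒∈ support-t , k , 2 , tx , Dist-2 (Edge-sym zt) (Edge-sym yz) t≢y ¬ty , k≢2
    where
    t≢y : t ≢ y
    t≢y refl = ¬support support-t
    ¬ty : ¬ Edge G t y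
    ¬ty ty = no-triangle (Edge-sym zt) (Edge-sym yz) (Edge-sym ty)
    -- A path t m x would close the 6-cycle x s y z t m.
    k≢2 : k ≢ 2
    k≢2 refl with Walk-2 (proj₁ tx)
    ... | m , tm , mx =
      no-hexagon xs (Edge-sym ys) yz zt tm mx x≢y x≢z x≢t s≢z s≢t s≢m (t≢y ∘ sym) y≢m z≢m
      where
      x≢z : x ≢ z
      x≢z refl = no-triangle xs (Edge-sym ys) yz
      x≢t : x ≢ t
      x≢t refl = no-square xs (Edge-sym ys) yz zt x≢y (z≢s ∘ sym)
      s≢z : s ≢ z
      s≢z = z≢s ∘ sym
      s≢t : s ≢ t
      s≢t refl = no-triangle (Edge-sym ys) yz zt
      s≢m : s ≢ m
      s≢m refl = no-square (Edge-sym ys) yz zt tm s≢z (t≢y ∘ sym)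
      y≢m : y ≢ m
      y≢m refl = no-triangle xs (Edge-sym ys) mx
      z≢m : z ≢ m
      z≢m refl = no-square xs (Edge-sym ys) yz mx x≢y s≢z

  resolve-siblings : ∀ {x y s} → x ≢ y → x ∉ supports∪shadowed → y ∉ supports∪shadowed →
    Edge G x s → Edge G y s → ResolvedBy supports∪shadowed x y
  resolve-siblings {x} {y} {s} x≢y x∉ y∉ xs ys with leaf? x | leaf? y
  ... | _ | no ¬leaf-y = resolve-beside-non-leaf x≢y ¬leaf-y (y∉ ∘ support⇒∈) xs ys
  ... | no ¬leaf-x | yes _ =
    ResolvedBy-sym (resolve-beside-non-leaf (x≢y ∘ sym) ¬leaf-x (x∉ ∘ support⇒∈) ys xs)
  ... | yes leaf-x | yes leaf-y with FP.<-cmp x y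
  ... | tri< x<y _ _ = ⊥-elim (y∉ (shadowed⇒∈ (leaf-y , x , x<y , leaf-x , s , ys , xs)))
  ... | tri≈ _ x≡y _ = ⊥-elim (x≢y x≡y)
  ... | tri> _ _ y<x = ⊥-elim (x∉ (shadowed⇒∈ (leaf-x , y , y<x , leaf-y , s , xs , ys)))

  supports∪shadowed-resolving : Resolving G supports∪shadowed
  supports∪shadowed-resolving x y x≢y with x ∈? supports∪shadowed | y ∈? supports∪shadowed
  ... | yes x∈ | _ = member-resolves x∈ x≢y
  ... | no _ | yes y∈ = ResolvedBy-sym (member-resolves y∈ (x≢y ∘ sym))
  ... | no x∉ | no y∉ with near-leaf-non-support⇒support-neighbour (near x) (x∉ ∘ support⇒∈)
  ... | s , support-s , xs with dist-exists s y
  ... | k , sy with k ℕ.≟ 1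
  ... | no k≢1 = s , support⇒∈ support-s , 1 , k , Dist-1 (Edge-sym xs) , sy , k≢1 ∘ sym
  ... | yes refl = resolve-siblings x≢y x∉ y∉ xs (Edge-sym (Walk-1 (proj₁ sy)))

  supports∪shadowed-mld : MetricLocatingDominating G supports∪shadowed
  supports∪shadowed-mld = supports∪shadowed-resolving , support-closed⇒dominating near support⇒∈

  unshadowed-leaf : ∀ {s} → Support s → ∃[ b ] (Edge G s b × IsLeaf G b × ¬ Shadowed b)
  unshadowed-leaf {s} (_ , sl , leaf) with least-Fin (λ b → edge? s b ×-dec leaf? b) (sl , leaf)
  ... | b , (sb , leaf-b) , minimal = b , sb , leaf-b , λ (_ , w , w<b , leaf-w , s′ , bs′ , ws′) →
    let s′≡s = leaf-neighbour-unique leaf-b bs′ (Edge-sym sb)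
    in ℕ.<⇒≱ w<b (minimal w (Edge-sym (subst (Edge G w) s′≡s ws′) , leaf-w))

  ShadowedSelfOrUnshadowedLeaf : Fin n → Fin n → Set
  ShadowedSelfOrUnshadowedLeaf v b =
    (Shadowed v × b ≡ v) ⊎ (Edge G v b × IsLeaf G b × ¬ Shadowed b)

  supports∪shadowed-into-leaves : RelatesInto ShadowedSelfOrUnshadowedLeaf supports∪shadowed (leaves G)
  supports∪shadowed-into-leaves v∈ with ∈subsetOf⁻ supports∪shadowed? v∈
  ... | inj₁ support with unshadowed-leaf support
  ... | b , vb , leaf , ¬shadowed = b , ∈leaves⁺ leaf , inj₂ (vb , leaf , ¬shadowed)
  supports∪shadowed-into-leaves v∈ | inj₂ shadowed =
    _ , ∈leaves⁺ (proj₁ shadowed) , inj₁ (shadowed , refl)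

  ShadowedSelfOrUnshadowedLeaf-injective : InjectiveOn ShadowedSelfOrUnshadowedLeaf supports∪shadowed
  ShadowedSelfOrUnshadowedLeaf-injective _ _ (inj₁ (_ , refl)) (inj₁ (_ , refl)) = refl
  ShadowedSelfOrUnshadowedLeaf-injective _ _ (inj₁ (shadowed , refl)) (inj₂ (_ , _ , ¬shadowed)) =
    ⊥-elim (¬shadowed shadowed)
  ShadowedSelfOrUnshadowedLeaf-injective _ _ (inj₂ (_ , _ , ¬shadowed)) (inj₁ (shadowed , refl)) =
    ⊥-elim (¬shadowed shadowed)
  ShadowedSelfOrUnshadowedLeaf-injective _ _ (inj₂ (vb , leaf , _)) (inj₂ (v′b , _ , _)) =
    leaf-neighbour-unique leaf (Edge-sym vb) (Edge-sym v′b)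

  near-leaf⇒γM-tight : MLDNumberIs G (numLeaves G)
  near-leaf⇒γM-tight =
    (supports∪shadowed , supports∪shadowed-mld , ∣S∣≡numLeaves) , λ _ → numLeaves≤mld
    where
    ∣S∣≡numLeaves : ∣ supports∪shadowed ∣ ≡ numLeaves G
    ∣S∣≡numLeaves = ℕ.≤-antisym
      (injection⇒∣p∣≤∣q∣ _ supports∪shadowed-into-leaves ShadowedSelfOrUnshadowedLeaf-injective)
      (numLeaves≤mld supports∪shadowed-mld)

theorem4 : ∀ {n} (T : Graph n) → 2 ≤ n → IsTree T → n ≢ 2 →
    (MLDNumberIs T (numLeaves T) ⇔ DominationNumberIs T (numSupports T))
    × (DominationNumberIs T (numSupports T)
        ⇔ (∀ u → ∃[ v ] (IsLeaf T v × ∃[ k ] (k ≤ 2 × Dist T u v k))))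
theorem4 {n} T 2≤n (connected , acyclic) n≢2 =
  mk⇔ (near-leaf⇒γ-tight ∘ γM-tight⇒near-leaf) (near-leaf⇒γM-tight ∘ γ-tight⇒near-leaf) ,
  mk⇔ γ-tight⇒near-leaf near-leaf⇒γ-tight
  where
  3≤n : 3 ≤ n
  3≤n = ℕ.≤∧≢⇒< 2≤n (n≢2 ∘ sym)
  open LowerBounds T connected 3≤n
  open Construction T connected 3≤n acyclic using (near-leaf⇒γM-tight)
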